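{- Let $q\ge2$ be an integer and let $(p_n)_{n\ge0}$ be defined by $p_0=\dots=p_{q-2}=0$, $p_{q-1}=1$ and $p_{n+q}=p_{n+1}+p_n$ for $n\ge0$. Then $$p_n=c_{n-q+1}(q-1\text{ or }q)\quad (n\ge q),$$ and, for all $n\ge1$, $$p_n=c_n\big(q-1\ (\mathrm{mod}\ q)\big),\qquad p_n=c_{n+1}\big(1\ (\mathrm{mod}\ q-1)\text{ and }\ne1\big).$$
   Context: A composition of $m$ with parts in a set $S$ of positive integers is an ordered tuple of elements of $S$ summing to $m$; $c_m(S)$ denotes their number. Here $c_m(q-1\text{ or }q)$ counts compositions with parts in $\{q-1,q\}$; $c_m(q-1\ (\mathrm{mod}\ q))$ counts those with all parts congruent to $q-1$ modulo $q$; $c_m(1\ (\mathrm{mod}\ q-1)\text{ and }\ne1)$ counts those with all parts congruent to $1$ modulo $q-1$ and different from $1$ (for $q=2$: all parts $\ge2$). -}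

module Defs where

open import Data.Nat using (ℕ; zero; suc; _∸_; _%_; _≡ᵇ_)
import Data.Bool as Bool
open import Data.Bool using (Bool; _∨_; _∧_; not)
open import Data.List using (List; []; _∷_; [_]; map; concatMap; upTo; filterᵇ; length)

-- All compositions (ordered tuples of positive integers) of m.
-- comps f m : fuel f ≥ m; the first part is suc k with 0 ≤ k ≤ m - 1 … m,
-- the remainder is a composition of (suc m) - (suc k) = m ∸ k.
comps : ℕ → ℕ → List (List ℕ)
comps _       zero    = [ [] ]
comps zero    (suc m) = []
comps (suc f) (suc m) =
  concatMap (λ k → map (suc k ∷_) (comps f (m ∸ k))) (upTo (suc m))

compositions : ℕ → List (List ℕ)
compositions m = comps m m

allParts : (ℕ → Bool) → List ℕ → Bool
allParts S []       = Bool.true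
allParts S (k ∷ ks) = S k ∧ allParts S ks

c : ℕ → (ℕ → Bool) → ℕ
c m S = length (filterᵇ (allParts S) (compositions m))

-- congruence a ≡ b (mod n); for n = 0 this is equality
_≡ᵇ_[mod_] : ℕ → ℕ → ℕ → Bool
a ≡ᵇ b [mod zero ]  = a ≡ᵇ b
a ≡ᵇ b [mod suc n ] = (a % suc n) ≡ᵇ (b % suc n)

q-1-or-q : ℕ → ℕ → Bool
q-1-or-q q k = (k ≡ᵇ (q ∸ 1)) ∨ (k ≡ᵇ q)

q-1-mod-q : ℕ → ℕ → Bool
q-1-mod-q q k = k ≡ᵇ (q ∸ 1) [mod q ]

1-mod-q-1-ne1 : ℕ → ℕ → Bool
1-mod-q-1-ne1 q k = (k ≡ᵇ 1 [mod (q ∸ 1) ]) ∧ not (k ≡ᵇ 1)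

module Submission where

-- Write q = r + 2.  The sequence p is the unique solution of the recurrence
-- a(n+q) = a(n+1) + a(n) with a(n) = 0 for n < q-1 and a(q-1) = 1
-- ('recurrence-unique', 'p-characterised'), so each of the three identities
-- follows once a suitable shift of the counting sequence is shown to have
-- these initial values and to satisfy this recurrence.
--
-- Classifying compositions by their first part s gives c₀(S) = 1 and
-- c_m(S) = Σ_{s ∈ S, s ≤ m} c_{m-s}(S) for m ≥ 1 ('c-suc').  We write the right
-- hand side as 'conv S f m', where 'delay s f m' reads f (m - s) as 0 when
-- m < s.  A small calculus for 'conv' (enlarging or splitting the range of
-- first parts, unions of disjoint part sets, a single part, removing the part 1)
-- gives, for general part sets:
--   parts {d+1, d+2}:                          conv f n = f(n-d-1) + f(n-d-2);
--   least part d+1, rest periodic mod d+2:     conv f (n+d+2) = f(n+1) + conv f n;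
--   parts ≥ d+2, periodic mod d+1 beyond 1:    conv f (n+d+2) = f n + conv f (n+1).
-- Applied to f = c(S), these are exactly the recurrence of p for the sequences
-- n ↦ c_{n-q+1}(q-1 or q), n ↦ c_n(q-1 mod q) (n ≥ 1) and n ↦ c_{n+1}(1 mod q-1, ≠ 1).

open import Defs
open import Data.Nat using (ℕ; zero; suc; _+_; _∸_; _≤_; _<_; _≡ᵇ_; _%_; _<?_; z≤n; s≤s; s≤s⁻¹)
open import Data.Nat.Properties
open import Data.Nat.DivMod using ([m+n]%n≡m%n; m<n⇒m%n≡m; n%n≡0)
open import Data.Nat.Induction using (<-rec)
open import Data.Bool using (Bool; true; false; _∧_; _∨_; not; T)
open import Data.Bool.Properties using (∧-zeroʳ)
open import Data.List using (List; []; _∷_; _++_; map; concatMap; applyUpTo; filterᵇ; length)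
open import Data.List.Properties using (length-++; filter-++)
open import Data.Product using (_×_; _,_)
open import Data.Sum using (inj₁; inj₂)
open import Data.Unit using (tt)
open import Function using (_∘_)
open import Relation.Binary.PropositionalEquality
open import Relation.Nullary using (yes; no; contradiction)
open import Algebra.Properties.CommutativeSemigroup +-commutativeSemigroup using (interchange)

open ≡-Reasoning

≡ᵇ-refl : ∀ n → (n ≡ᵇ n) ≡ true
≡ᵇ-refl zero    = refl
≡ᵇ-refl (suc n) = ≡ᵇ-refl n

≡ᵇ-true⇒≡ : ∀ {m n} → (m ≡ᵇ n) ≡ true → m ≡ n
≡ᵇ-true⇒≡ {m} {n} eq = ≡ᵇ⇒≡ m n (subst T (sym eq) tt)

≢⇒≡ᵇ-false : ∀ {m n} → m ≢ n → (m ≡ᵇ n) ≡ false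
≢⇒≡ᵇ-false {m} {n} m≢n with m ≡ᵇ n in eq
... | false = refl
... | true  = contradiction (≡ᵇ-true⇒≡ eq) m≢n

sumTo : ℕ → (ℕ → ℕ) → ℕ
sumTo zero    g = 0
sumTo (suc n) g = g 0 + sumTo n (g ∘ suc)

syntax sumTo n (λ k → e) = ∑[ k < n ] e

sum-cong : ∀ n {g h : ℕ → ℕ} → (∀ k → k < n → g k ≡ h k) → sumTo n g ≡ sumTo n h
sum-cong zero    eq = refl
sum-cong (suc n) eq = cong₂ _+_ (eq 0 (s≤s z≤n)) (sum-cong n (λ k k<n → eq (suc k) (s≤s k<n)))

sum-zero : ∀ n {g : ℕ → ℕ} → (∀ k → k < n → g k ≡ 0) → sumTo n g ≡ 0
sum-zero zero    eq = refl
sum-zero (suc n) eq = cong₂ _+_ (eq 0 (s≤s z≤n)) (sum-zero n (λ k k<n → eq (suc k) (s≤s k<n)))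

sum-+ : ∀ n (g h : ℕ → ℕ) → (∑[ k < n ] (g k + h k)) ≡ sumTo n g + sumTo n h
sum-+ zero    g h = refl
sum-+ (suc n) g h =
  trans (cong (g 0 + h 0 +_) (sum-+ n (g ∘ suc) (h ∘ suc))) (interchange (g 0) (h 0) _ _)

sum-split : ∀ a b (g : ℕ → ℕ) → sumTo (a + b) g ≡ sumTo a g + (∑[ k < b ] g (a + k))
sum-split zero    b g = refl
sum-split (suc a) b g = trans (cong (g 0 +_) (sum-split a b (g ∘ suc))) (sym (+-assoc (g 0) _ _))

sum-single : ∀ N j (g : ℕ → ℕ) → j < N → (∀ k → k < N → k ≢ j → g k ≡ 0) → sumTo N g ≡ g j
sum-single (suc N) zero g _ others =
  trans (cong (g 0 +_) (sum-zero N (λ k k<N → others (suc k) (s≤s k<N) (λ ())))) (+-identityʳ (g 0))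
sum-single (suc N) (suc j) g (s≤s j<N) others =
  cong₂ _+_ (others 0 (s≤s z≤n) (λ ()))
            (sum-single N j (g ∘ suc) j<N (λ k k<N k≢j → others (suc k) (s≤s k<N) (k≢j ∘ suc-injective)))

when : Bool → ℕ → ℕ
when true  x = x
when false x = 0

when-0 : ∀ b → when b 0 ≡ 0
when-0 true  = refl
when-0 false = refl

when-∨ : ∀ b b′ x → (b ≡ true → b′ ≡ false) → when (b ∨ b′) x ≡ when b x + when b′ x
when-∨ true  b′ x excl rewrite excl refl = sym (+-identityʳ x)
when-∨ false b′ x _    = refl

delay : ℕ → (ℕ → ℕ) → ℕ → ℕ
delay zero    f n       = f n
delay (suc d) f zero    = 0
delay (suc d) f (suc n) = delay d f n

delay-below : ∀ d f {n} → n < d → delay d f n ≡ 0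
delay-below (suc d) f {zero}  _          = refl
delay-below (suc d) f {suc n} (s≤s n<d) = delay-below d f n<d

delay-∸ : ∀ d f {n} → d ≤ n → delay d f n ≡ f (n ∸ d)
delay-∸ zero    f _          = refl
delay-∸ (suc d) f (s≤s d≤n) = delay-∸ d f d≤n

delay-shift : ∀ d s f n → delay (d + s) f (d + n) ≡ delay s f n
delay-shift zero    s f n = refl
delay-shift (suc d) s f n = delay-shift d s f n

delay-at : ∀ d f n → delay d f (d + n) ≡ f n
delay-at zero    f n = refl
delay-at (suc d) f n = delay-at d f n

convTo : (ℕ → Bool) → ℕ → (ℕ → ℕ) → ℕ → ℕ
convTo T N f n = ∑[ k < N ] when (T (suc k)) (delay (suc k) f n)

conv : (ℕ → Bool) → (ℕ → ℕ) → ℕ → ℕ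
conv T f n = convTo T n f n

-- Parts larger than n contribute nothing.
convTo-extend : ∀ T f {n N} → n ≤ N → convTo T N f n ≡ conv T f n
convTo-extend T f {n} {N} n≤N = begin
  convTo T N f n
    ≡⟨ cong (λ M → convTo T M f n) (sym (m+[n∸m]≡n n≤N)) ⟩
  convTo T (n + (N ∸ n)) f n
    ≡⟨ sum-split n (N ∸ n) _ ⟩
  conv T f n + (∑[ k < N ∸ n ] when (T (suc (n + k))) (delay (suc (n + k)) f n))
    ≡⟨ cong (conv T f n +_) (sum-zero (N ∸ n) (λ k _ → beyond k)) ⟩
  conv T f n + 0
    ≡⟨ +-identityʳ _ ⟩
  conv T f n ∎
  where
  beyond : ∀ k → when (T (suc (n + k))) (delay (suc (n + k)) f n) ≡ 0
  beyond k = trans (cong (when _) (delay-below (suc (n + k)) f (s≤s (m≤m+n n k)))) (when-0 _)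

conv-split : ∀ T d f n → conv T f (d + n) ≡ convTo T d f (d + n) + conv (λ s → T (d + s)) f n
conv-split T d f n =
  trans (sum-split d n _) (cong (convTo T d f (d + n) +_) (sum-cong n (λ k _ → shifted k)))
  where
  shifted : ∀ k → when (T (suc (d + k))) (delay (suc (d + k)) f (d + n))
                ≡ when (T (d + suc k)) (delay (suc k) f n)
  shifted k rewrite sym (+-suc d k) = cong (when (T (d + suc k))) (delay-shift d (suc k) f n)

conv-suc : ∀ T f n → conv T f (suc n) ≡ when (T 1) (f n) + conv (T ∘ suc) f n
conv-suc T f n = refl

convTo-congT : ∀ T U N f n → (∀ k → k < N → T (suc k) ≡ U (suc k)) → convTo T N f n ≡ convTo U N f n
convTo-congT T U N f n eq = sum-cong N (λ k k<N → cong (λ b → when b _) (eq k k<N))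

conv-congT : ∀ T U f n → (∀ k → T (suc k) ≡ U (suc k)) → conv T f n ≡ conv U f n
conv-congT T U f n eq = convTo-congT T U n f n (λ k _ → eq k)

convTo-none : ∀ T N f n → (∀ k → k < N → T (suc k) ≡ false) → convTo T N f n ≡ 0
convTo-none T N f n none = sum-zero N (λ k k<N → cong (λ b → when b _) (none k k<N))

convTo-∨ : ∀ T U N f n → (∀ s → T s ≡ true → U s ≡ false)
         → convTo (λ s → T s ∨ U s) N f n ≡ convTo T N f n + convTo U N f n
convTo-∨ T U N f n excl =
  trans (sum-cong N (λ k _ → when-∨ (T (suc k)) (U (suc k)) _ (excl (suc k)))) (sum-+ N _ _)

convTo-point : ∀ d N f n → d < N → convTo (_≡ᵇ suc d) N f n ≡ delay (suc d) f n
convTo-point d N f n d<N = begin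
  convTo (_≡ᵇ suc d) N f n
    ≡⟨ sum-single N d (λ k → when (suc k ≡ᵇ suc d) (delay (suc k) f n)) d<N
         (λ k _ k≢d → cong (λ b → when b (delay (suc k) f n)) (≢⇒≡ᵇ-false k≢d)) ⟩
  when (d ≡ᵇ d) (delay (suc d) f n)
    ≡⟨ cong (λ b → when b (delay (suc d) f n)) (≡ᵇ-refl d) ⟩
  delay (suc d) f n ∎

convTo-least : ∀ T d f n → (∀ k → k < d → T (suc k) ≡ false) → T (suc d) ≡ true
             → convTo T (suc d) f n ≡ delay (suc d) f n
convTo-least T d f n below least =
  trans (convTo-congT T (_≡ᵇ suc d) (suc d) f n agree) (convTo-point d (suc d) f n ≤-refl)
  where
  agree : ∀ k → k < suc d → T (suc k) ≡ (k ≡ᵇ d)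
  agree k k<d+1 with m≤n⇒m<n∨m≡n (s≤s⁻¹ k<d+1)
  ... | inj₁ k<d  = trans (below k k<d) (sym (≢⇒≡ᵇ-false (<⇒≢ k<d)))
  ... | inj₂ refl = trans least (sym (≡ᵇ-refl k))

conv-two-parts : ∀ d f n
  → conv (λ s → (s ≡ᵇ suc d) ∨ (s ≡ᵇ suc (suc d))) f n ≡ delay (suc d) f n + delay (suc (suc d)) f n
conv-two-parts d f n = begin
  conv (λ s → (s ≡ᵇ suc d) ∨ (s ≡ᵇ suc (suc d))) f n
    ≡⟨ convTo-extend (λ s → (s ≡ᵇ suc d) ∨ (s ≡ᵇ suc (suc d))) f (m≤n+m n N₀) ⟨
  convTo (λ s → (s ≡ᵇ suc d) ∨ (s ≡ᵇ suc (suc d))) (N₀ + n) f n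
    ≡⟨ convTo-∨ (_≡ᵇ suc d) (_≡ᵇ suc (suc d)) (N₀ + n) f n disjoint ⟩
  convTo (_≡ᵇ suc d) (N₀ + n) f n + convTo (_≡ᵇ suc (suc d)) (N₀ + n) f n
    ≡⟨ cong₂ _+_ (convTo-point d (N₀ + n) f n (≤-trans (n≤1+n _) (m≤m+n N₀ n)))
                 (convTo-point (suc d) (N₀ + n) f n (m≤m+n N₀ n)) ⟩
  delay (suc d) f n + delay (suc (suc d)) f n ∎
  where
  N₀ : ℕ
  N₀ = suc (suc d)
  disjoint : ∀ s → (s ≡ᵇ suc d) ≡ true → (s ≡ᵇ suc (suc d)) ≡ false
  disjoint s eq rewrite ≡ᵇ-true⇒≡ {s} eq = ≢⇒≡ᵇ-false {suc d} {suc (suc d)} (1+n≢n ∘ sym)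

-- Least part d+1, no part d+2, and the part set periodic with period d+2:
-- a first part s ≥ d+3 corresponds to the first part s-(d+2) of a composition of n.
conv-least-then-periodic : ∀ T d f n
  → (∀ k → k < d → T (suc k) ≡ false) → T (suc d) ≡ true → T (suc (suc d)) ≡ false
  → (∀ s → T (suc (suc d) + s) ≡ T s)
  → conv T f (suc d + suc n) ≡ f (suc n) + conv T f n
conv-least-then-periodic T d f n below least gap periodic = begin
  conv T f (suc d + suc n)
    ≡⟨ conv-split T (suc d) f (suc n) ⟩
  convTo T (suc d) f (suc d + suc n) + conv (λ s → T (suc d + s)) f (suc n)
    ≡⟨ cong₂ _+_ (trans (convTo-least T d f (suc d + suc n) below least) (delay-at (suc d) f (suc n)))
                 (trans (conv-suc (λ s → T (suc d + s)) f n)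
                        (cong (λ b → when b (f n) + conv (λ s → T (suc d + suc s)) f n) gap′)) ⟩
  f (suc n) + conv (λ s → T (suc d + suc s)) f n
    ≡⟨ cong (f (suc n) +_) (conv-congT (λ s → T (suc d + suc s)) T f n (λ k → trans (cong T (shift k)) (periodic (suc k)))) ⟩
  f (suc n) + conv T f n ∎
  where
  gap′ : T (suc d + 1) ≡ false
  gap′ = trans (cong T (+-comm (suc d) 1)) gap
  shift : ∀ k → suc d + suc (suc k) ≡ suc (suc d) + suc k
  shift k = cong suc (+-suc d (suc k))

-- Parts all ≥ d+2, containing d+2, and periodic with period d+1 among parts ≥ 2:
-- a first part s ≥ d+3 corresponds to the first part s-(d+1) ≥ 2.
conv-least-then-shift : ∀ T d f n
  → (∀ k → k < suc d → T (suc k) ≡ false) → T (suc (suc d)) ≡ true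
  → (∀ s → T (suc d + suc (suc s)) ≡ T (suc (suc s)))
  → conv T f (suc d + suc n) ≡ f n + conv T f (suc n)
conv-least-then-shift T d f n below least periodic = begin
  conv T f (suc d + suc n)
    ≡⟨ conv-split T (suc d) f (suc n) ⟩
  convTo T (suc d) f (suc d + suc n) + conv (λ s → T (suc d + s)) f (suc n)
    ≡⟨ cong₂ _+_ (convTo-none T (suc d) f (suc d + suc n) below)
                 (trans (conv-suc (λ s → T (suc d + s)) f n)
                        (cong (λ b → when b (f n) + conv (λ s → T (suc d + suc s)) f n)
                              (trans (cong T (+-comm (suc d) 1)) least))) ⟩
  f n + conv (λ s → T (suc d + suc s)) f n
    ≡⟨ cong (f n +_) (conv-congT (λ s → T (suc d + suc s)) (T ∘ suc) f n periodic) ⟩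
  f n + conv (T ∘ suc) f n
    ≡⟨ cong (f n +_) (trans (conv-suc T f n) (cong (λ b → when b (f n) + conv (T ∘ suc) f n) (below 0 (s≤s z≤n)))) ⟨
  f n + conv T f (suc n) ∎

count : (ℕ → Bool) → ℕ → ℕ → ℕ
count S f m = length (filterᵇ (allParts S) (comps f m))

counts : (ℕ → Bool) → ℕ → ℕ
counts S m = c m S

length-filter-concatMap : ∀ {A B : Set} (P : B → Bool) (h : A → List B) (g : ℕ → A) n
  → length (filterᵇ P (concatMap h (applyUpTo g n))) ≡ ∑[ k < n ] length (filterᵇ P (h (g k)))
length-filter-concatMap P h g zero    = refl
length-filter-concatMap {B = B} P h g (suc n) = begin
  length (filterᵇ P (h (g 0) ++ rest))
    ≡⟨ cong length (filter-++ _ (h (g 0)) rest) ⟩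
  length (filterᵇ P (h (g 0)) ++ filterᵇ P rest)
    ≡⟨ length-++ (filterᵇ P (h (g 0))) ⟩
  length (filterᵇ P (h (g 0))) + length (filterᵇ P rest)
    ≡⟨ cong (length (filterᵇ P (h (g 0))) +_) (length-filter-concatMap P h (g ∘ suc) n) ⟩
  (∑[ k < suc n ] length (filterᵇ P (h (g k)))) ∎
  where
  rest : List B
  rest = concatMap h (applyUpTo (g ∘ suc) n)

count-prefix : ∀ S s (L : List (List ℕ))
  → length (filterᵇ (allParts S) (map (s ∷_) L)) ≡ when (S s) (length (filterᵇ (allParts S) L))
count-prefix S s []      = sym (when-0 (S s))
count-prefix S s (l ∷ L) with S s | allParts S l | count-prefix S s L
... | true  | true  | ih = cong suc ih
... | true  | false | ih = ih
... | false | _     | ih = ih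

count-suc : ∀ S f m → count S (suc f) (suc m) ≡ ∑[ k < suc m ] when (S (suc k)) (count S f (m ∸ k))
count-suc S f m =
  trans (length-filter-concatMap (allParts S) (λ k → map (suc k ∷_) (comps f (m ∸ k))) (λ k → k) (suc m))
        (sum-cong (suc m) (λ k _ → count-prefix S (suc k) (comps f (m ∸ k))))

count-fuel : ∀ S f g m → m ≤ f → m ≤ g → count S f m ≡ count S g m
count-fuel S f       g       zero    _          _          = refl
count-fuel S (suc f) (suc g) (suc m) (s≤s m≤f) (s≤s m≤g) = begin
  count S (suc f) (suc m)
    ≡⟨ count-suc S f m ⟩
  (∑[ k < suc m ] when (S (suc k)) (count S f (m ∸ k)))
    ≡⟨ sum-cong (suc m) (λ k _ → cong (when (S (suc k)))
         (count-fuel S f g (m ∸ k) (≤-trans (m∸n≤m m k) m≤f) (≤-trans (m∸n≤m m k) m≤g))) ⟩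
  (∑[ k < suc m ] when (S (suc k)) (count S g (m ∸ k)))
    ≡⟨ count-suc S g m ⟨
  count S (suc g) (suc m) ∎

c-suc : ∀ S m → counts S (suc m) ≡ conv S (counts S) (suc m)
c-suc S m = trans (count-suc S m m) (sum-cong (suc m) term)
  where
  term : ∀ k → k < suc m → when (S (suc k)) (count S m (m ∸ k)) ≡ when (S (suc k)) (delay k (counts S) m)
  term k k<m+1 = cong (when (S (suc k)))
    (trans (count-fuel S m (m ∸ k) (m ∸ k) (m∸n≤m m k) ≤-refl) (sym (delay-∸ k (counts S) (s≤s⁻¹ k<m+1))))

recurrence-unique : ∀ r (a b : ℕ → ℕ)
  → (∀ n → n < suc (suc r) → a n ≡ b n)
  → (∀ n → a (n + suc (suc r)) ≡ a (suc n) + a n)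
  → (∀ n → b (n + suc (suc r)) ≡ b (suc n) + b n)
  → ∀ n → a n ≡ b n
recurrence-unique r a b initial a-rec b-rec = <-rec (λ n → a n ≡ b n) agree
  where
  agree : ∀ n → (∀ {m} → m < n → a m ≡ b m) → a n ≡ b n
  agree n ih with n <? suc (suc r)
  ... | yes n<q = initial n n<q
  ... | no n≮q with n ∸ suc (suc r) | m∸n+n≡m (≮⇒≥ n≮q)
  ...   | m | refl = begin
    a (m + suc (suc r))   ≡⟨ a-rec m ⟩
    a (suc m) + a m       ≡⟨ cong₂ _+_ (ih m+1<m+q) (ih (m<m+n m (s≤s z≤n))) ⟩
    b (suc m) + b m       ≡⟨ b-rec m ⟨
    b (m + suc (suc r))   ∎
    where
    m+1<m+q : suc m < m + suc (suc r)
    m+1<m+q = subst (_< m + suc (suc r)) (+-comm m 1) (+-monoʳ-< m (s≤s (s≤s z≤n)))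

module _ (r : ℕ) (p : ℕ → ℕ)
         (p-zero : ∀ n → n < suc r → p n ≡ 0) (p-one : p (suc r) ≡ 1)
         (p-rec : ∀ n → p (n + suc (suc r)) ≡ p (suc n) + p n) where

  private
    q : ℕ
    q = suc (suc r)

    -- n + q written so that the first q-1 indices are split off
    n+q≡ : ∀ n → n + q ≡ suc r + suc n
    n+q≡ n = trans (+-comm n q) (sym (cong suc (+-suc r n)))

  p-characterised : ∀ (a g : ℕ → ℕ) → g 0 ≡ 1
    → (∀ n → n < q → a n ≡ delay (suc r) g n)
    → (∀ n → a (n + q) ≡ a (suc n) + a n)
    → ∀ n → p n ≡ a n
  p-characterised a g g0 a-init a-rec = recurrence-unique r p a initial p-rec a-rec
    where
    initial : ∀ n → n < q → p n ≡ a n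
    initial n n<q with m≤n⇒m<n∨m≡n (s≤s⁻¹ n<q)
    ... | inj₁ n<r+1 = trans (p-zero n n<r+1) (sym (trans (a-init n n<q) (delay-below (suc r) g n<r+1)))
    ... | inj₂ refl  = trans p-one (sym (begin
      a (suc r)                 ≡⟨ a-init (suc r) n<q ⟩
      delay (suc r) g (suc r)   ≡⟨ delay-∸ (suc r) g ≤-refl ⟩
      g (r ∸ r)                 ≡⟨ cong g (n∸n≡0 r) ⟩
      g 0                       ≡⟨ g0 ⟩
      1                         ∎))

  p≡c-two-parts : ∀ n → p n ≡ delay (suc r) (counts (q-1-or-q q)) n
  p≡c-two-parts = p-characterised _ cnt refl (λ _ _ → refl) rec
    where
    cnt : ℕ → ℕ
    cnt = counts (q-1-or-q q)
    rec : ∀ n → delay (suc r) cnt (n + q) ≡ delay (suc r) cnt (suc n) + delay (suc r) cnt n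
    rec n = begin
      delay (suc r) cnt (n + q)          ≡⟨ cong (delay (suc r) cnt) (n+q≡ n) ⟩
      delay (suc r) cnt (suc r + suc n)  ≡⟨ delay-at (suc r) cnt (suc n) ⟩
      cnt (suc n)                        ≡⟨ c-suc (q-1-or-q q) n ⟩
      conv (q-1-or-q q) cnt (suc n)      ≡⟨ conv-two-parts r cnt (suc n) ⟩
      delay (suc r) cnt (suc n) + delay (suc r) cnt n ∎

  private
    S₂ : ℕ → Bool
    S₂ = q-1-mod-q q

    S₂-below : ∀ k → k < r → S₂ (suc k) ≡ false
    S₂-below k k<r
      rewrite m<n⇒m%n≡m {n = q} {m = suc k} (s≤s (≤-trans k<r (n≤1+n r)))
            | m<n⇒m%n≡m {n = q} {m = suc r} ≤-refl = ≢⇒≡ᵇ-false (<⇒≢ k<r)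

    S₂-least : S₂ (suc r) ≡ true
    S₂-least = ≡ᵇ-refl (suc r % q)

    S₂-gap : S₂ q ≡ false
    S₂-gap = cong₂ _≡ᵇ_ (n%n≡0 q) (m<n⇒m%n≡m {n = q} ≤-refl)

    S₂-periodic : ∀ s → S₂ (q + s) ≡ S₂ s
    S₂-periodic s = cong (_≡ᵇ (suc r % q)) (trans (cong (_% q) (+-comm q s)) ([m+n]%n≡m%n s q))

  p≡c-mod : ∀ n → p n ≡ conv S₂ (counts S₂) n
  p≡c-mod = p-characterised _ cnt refl initial rec
    where
    cnt : ℕ → ℕ
    cnt = counts S₂
    initial : ∀ n → n < q → conv S₂ cnt n ≡ delay (suc r) cnt n
    initial n n<q = trans (sym (convTo-extend S₂ cnt (s≤s⁻¹ n<q)))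
                          (convTo-least S₂ r cnt n S₂-below S₂-least)
    rec : ∀ n → conv S₂ cnt (n + q) ≡ conv S₂ cnt (suc n) + conv S₂ cnt n
    rec n = begin
      conv S₂ cnt (n + q)              ≡⟨ cong (conv S₂ cnt) (n+q≡ n) ⟩
      conv S₂ cnt (suc r + suc n)      ≡⟨ conv-least-then-periodic S₂ r cnt n S₂-below S₂-least S₂-gap S₂-periodic ⟩
      cnt (suc n) + conv S₂ cnt n      ≡⟨ cong (_+ conv S₂ cnt n) (c-suc S₂ n) ⟩
      conv S₂ cnt (suc n) + conv S₂ cnt n ∎

  private
    S₃ : ℕ → Bool
    S₃ = 1-mod-q-1-ne1 q

    S₃-below : ∀ k → k < suc r → S₃ (suc k) ≡ false
    S₃-below zero    _ = ∧-zeroʳ _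
    S₃-below (suc k) (s≤s k<r) with m≤n⇒m<n∨m≡n k<r
    ... | inj₁ k+1<r
      rewrite m<n⇒m%n≡m {n = suc r} {m = suc (suc k)} (s≤s k+1<r)
            | m<n⇒m%n≡m {n = suc r} {m = 1} (s≤s (≤-trans (s≤s z≤n) k<r)) = refl
    ... | inj₂ refl =
      cong (_∧ true) (cong₂ _≡ᵇ_ (n%n≡0 (suc (suc k))) (m<n⇒m%n≡m {n = suc (suc k)} (s≤s (s≤s z≤n))))

    S₃-least : S₃ q ≡ true
    S₃-least = cong (_∧ true) (trans (cong (_≡ᵇ (1 % suc r)) ([m+n]%n≡m%n 1 (suc r))) (≡ᵇ-refl (1 % suc r)))

    S₃-periodic : ∀ s → S₃ (suc r + suc (suc s)) ≡ S₃ (suc (suc s))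
    S₃-periodic s = cong₂ _∧_
      (cong (_≡ᵇ (1 % suc r)) (trans (cong (_% suc r) (+-comm (suc r) s′)) ([m+n]%n≡m%n s′ (suc r))))
      (cong not (≢⇒≡ᵇ-false {suc r + s′} {1} (m+1+n≢0 r ∘ suc-injective)))
      where
      s′ : ℕ
      s′ = suc (suc s)

  p≡c-ne1 : ∀ n → p n ≡ counts S₃ (suc n)
  p≡c-ne1 = p-characterised _ cnt refl initial rec
    where
    cnt : ℕ → ℕ
    cnt = counts S₃
    initial : ∀ n → n < q → cnt (suc n) ≡ delay (suc r) cnt n
    initial n n<q = begin
      cnt (suc n)                   ≡⟨ c-suc S₃ n ⟩
      conv S₃ cnt (suc n)           ≡⟨ convTo-extend S₃ cnt n<q ⟨
      convTo S₃ q cnt (suc n)       ≡⟨ convTo-least S₃ (suc r) cnt (suc n) S₃-below S₃-least ⟩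
      delay (suc r) cnt n           ∎
    rec : ∀ n → cnt (suc (n + q)) ≡ cnt (suc (suc n)) + cnt (suc n)
    rec n = begin
      cnt (suc (n + q))                  ≡⟨ cong cnt (trans (cong suc (n+q≡ n)) (sym (+-suc (suc r) (suc n)))) ⟩
      cnt (suc r + suc (suc n))          ≡⟨ c-suc S₃ (r + suc (suc n)) ⟩
      conv S₃ cnt (suc r + suc (suc n))  ≡⟨ conv-least-then-shift S₃ r cnt (suc n) S₃-below S₃-least S₃-periodic ⟩
      cnt (suc n) + conv S₃ cnt (suc (suc n)) ≡⟨ cong (cnt (suc n) +_) (c-suc S₃ (suc n)) ⟨
      cnt (suc n) + cnt (suc (suc n))    ≡⟨ +-comm (cnt (suc n)) _ ⟩
      cnt (suc (suc n)) + cnt (suc n)    ∎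

theorem7 : (q : ℕ) → 2 ≤ q → (p : ℕ → ℕ)
    → (∀ n → n < q ∸ 1 → p n ≡ 0)
    → p (q ∸ 1) ≡ 1
    → (∀ n → p (n + q) ≡ p (suc n) + p n)
    → (∀ n → q ≤ n → p n ≡ c (n ∸ (q ∸ 1)) (q-1-or-q q))
    × (∀ n → 1 ≤ n → (p n ≡ c n (q-1-mod-q q)) × (p n ≡ c (suc n) (1-mod-q-1-ne1 q)))
theorem7 (suc (suc r)) (s≤s (s≤s z≤n)) p p-zero p-one p-rec = two-parts , λ { (suc m) _ → mod m , ne1 (suc m) }
  where
  two-parts : ∀ n → suc (suc r) ≤ n → p n ≡ c (n ∸ suc r) (q-1-or-q (suc (suc r)))
  two-parts n q≤n = trans (p≡c-two-parts r p p-zero p-one p-rec n)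
                          (delay-∸ (suc r) _ (≤-trans (n≤1+n (suc r)) q≤n))
  mod : ∀ m → p (suc m) ≡ c (suc m) (q-1-mod-q (suc (suc r)))
  mod m = trans (p≡c-mod r p p-zero p-one p-rec (suc m)) (sym (c-suc _ m))
  ne1 : ∀ n → p n ≡ c (suc n) (1-mod-q-1-ne1 (suc (suc r)))
  ne1 = p≡c-ne1 r p p-zero p-one p-rec
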